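{- There is an absolute constant $C$ such that for every integer $k\ge 0$ and every $n\ge 2$, every $n$-vertex graph of clique-width at most $k$ has a partial orientation $\vec{H}$ of maximum outdegree $O(k\log n)$ (i.e., at most $Ck\log n$) which is a weak $\infty$-guidance system.
   Context: All graphs are finite, simple and undirected. A $k$-labeled graph is a graph with each vertex assigned a label from $\{1,\dots,k\}$. The constructible $k$-labeled graphs are the smallest family closed under: a single labeled vertex; disjoint union of at least two constructible $k$-labeled graphs; changing all labels $i$ to $j$ (for some $i,j\in[k]$); adding all edges between vertices with labels $i$ and $j$ (for some $i,j\in[k]$). A graph has clique-width at most $k$ if its vertices can be labeled so that the resulting $k$-labeled graph is constructible. A partial orientation of $G$ is a directed graph $\vec{H}$ on $V(G)$ whose arcs $(u,v)$ satisfy $uv\in E(G)$; $B_{\vec{H}}(v,a)$ is the set of vertices reachable from $v$ by directed paths of length at most $a$. A weak $\infty$-guidance system is a partial orientation $\vec{H}$ such that for any distinct $u,v$ at finite distance $\ell$ in $G$ there are non-negative integers $a,b$ with $a+b=\ell-1$ and an edge of $G$ between $B_{\vec{H}}(u,a)$ and $B_{\vec{H}}(v,b)$. Logarithms are natural. -}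

module Defs where

open import Data.Nat using (ℕ; zero; suc; _+_; _*_; _≤_; _<_)
open import Data.Nat.Logarithm using (⌈log₂_⌉)
open import Data.Fin using (Fin; splitAt)
open import Data.Fin.Properties using (_≟_)
open import Data.Bool using (Bool; true; false; if_then_else_; _∧_; _∨_)
open import Data.Sum using (_⊎_; inj₁; inj₂)
open import Data.Product using (Σ; ∃; ∃-syntax; _×_; _,_)
open import Data.List using (List; map; allFin)
open import Data.Nat.ListAction using (sum)
open import Relation.Binary.PropositionalEquality using (_≡_; _≢_)
open import Relation.Nullary using (¬_; does)
open import Function.Bundles using (_⤖_; Bijection)

record Graph (n : ℕ) : Set where
  field
    adj   : Fin n → Fin n → Bool
    sym   : ∀ u v → adj u v ≡ adj v u
    irrefl : ∀ v → adj v v ≡ false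
open Graph public

data CWExpr (k : ℕ) : Set where
  vtx    : Fin k → CWExpr k
  _⊕_    : CWExpr k → CWExpr k → CWExpr k
  relab  : Fin k → Fin k → CWExpr k → CWExpr k    -- change all labels i to j
  join   : Fin k → Fin k → CWExpr k → CWExpr k

size : ∀ {k} → CWExpr k → ℕ
size (vtx _)       = 1
size (a ⊕ b)       = size a + size b
size (relab _ _ t) = size t
size (join _ _ t)  = size t

_=ᵇ_ : ∀ {m} → Fin m → Fin m → Bool
x =ᵇ y = does (x ≟ y)

label : ∀ {k} (t : CWExpr k) → Fin (size t) → Fin k
label (vtx i) _ = i
label (a ⊕ b) x with splitAt (size a) x
... | inj₁ x′ = label a x′
... | inj₂ x′ = label b x′
label (relab i j t) x = if label t x =ᵇ i then j else label t x
label (join _ _ t) x = label t x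

-- adjacency of the labeled graph denoted by an expression
-- (edges are only added between distinct vertices, so the graph stays simple)
edge : ∀ {k} (t : CWExpr k) → Fin (size t) → Fin (size t) → Bool
edge (vtx _) _ _ = false
edge (a ⊕ b) x y with splitAt (size a) x | splitAt (size a) y
... | inj₁ x′ | inj₁ y′ = edge a x′ y′
... | inj₂ x′ | inj₂ y′ = edge b x′ y′
... | inj₁ _  | inj₂ _  = false
... | inj₂ _  | inj₁ _  = false
edge (relab _ _ t) x y = edge t x y
edge (join i j t) x y =
  edge t x y ∨
  ((if x =ᵇ y then false else true) ∧
   ((label t x =ᵇ i ∧ label t y =ᵇ j) ∨ (label t x =ᵇ j ∧ label t y =ᵇ i)))

CliqueWidth≤ : ∀ {n} → ℕ → Graph n → Set
CliqueWidth≤ {n} k G =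
  Σ (CWExpr k) λ t → Σ (Fin n ⤖ Fin (size t)) λ f →
    ∀ u v → adj G u v ≡ edge t (Bijection.to f u) (Bijection.to f v)

data Walk {n} (G : Graph n) : Fin n → Fin n → ℕ → Set where
  stay : ∀ {v} → Walk G v v 0
  step : ∀ {u w v ℓ} → adj G u w ≡ true → Walk G w v ℓ → Walk G u v (suc ℓ)

Dist : ∀ {n} → Graph n → Fin n → Fin n → ℕ → Set
Dist G u v ℓ = Walk G u v ℓ × (∀ m → m < ℓ → ¬ Walk G u v m)

Digraph : ℕ → Set
Digraph n = Fin n → Fin n → Bool

IsPartialOrientation : ∀ {n} → Graph n → Digraph n → Set
IsPartialOrientation G H = ∀ u v → H u v ≡ true → adj G u v ≡ true

outdeg : ∀ {n} → Digraph n → Fin n → ℕ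
outdeg {n} H v = sum (map (λ u → if H v u then 1 else 0) (allFin n))

data InBall {n} (H : Digraph n) : Fin n → ℕ → Fin n → Set where
  here  : ∀ {v a} → InBall H v a v
  there : ∀ {v w x a} → H v w ≡ true → InBall H w a x → InBall H v (suc a) x

WeakGuidance : ∀ {n} → Graph n → Digraph n → Set
WeakGuidance {n} G H =
  ∀ (u v : Fin n) (ℓ : ℕ) → u ≢ v → Dist G u v ℓ →
    ∃[ a ] ∃[ b ] (suc (a + b) ≡ ℓ ×
      ∃[ x ] ∃[ y ] (InBall H u a x × InBall H v b y × adj G x y ≡ true))

{-# OPTIONS --safe #-}
module Submission where

-- A clique-width expression of G provides, for every vertex set P with |P| ≥ 2, a cut
-- (S, V ∖ S) splitting P into two parts of size at most 2|P|/3, where S is the vertex set of a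
-- subexpression: its at most k label classes consist of twins with respect to V ∖ S.  Cutting
-- recursively, 2⌈log₂ n⌉ levels suffice, since (3/2)^(2⌈log₂ n⌉) ≥ n.  On each level a vertex w
-- of the current part P gets, for every label class, an arc along a shortest path inside P
-- towards that class, and one towards the vertices outside S adjacent to the class.  A shortest
-- u–v path inside P either stays on one side of the cut, and is dealt with on the next level,
-- or, up to reversal, crosses it by an edge pq with p ∈ S and q ∉ S.  Then the arcs lead u into
-- the class of p within dist(u, p) steps and v to a neighbour of that class within dist(q, v)
-- steps, and since the class consists of twins with respect to V ∖ S, the endpoints are adjacent.

open import Defs renaming (sym to adj-sym)

open import Data.Bool using (Bool; true; false; not; _∧_; _∨_; if_then_else_)
open import Data.Bool.Properties
  using (∧-comm; ∧-conicalˡ; ∧-conicalʳ; ∧-identityʳ; ∧-zeroʳ; ∨-zeroʳ; not-injective)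
import Data.Bool.Properties as Bool
open import Data.Empty using (⊥-elim)
open import Data.Fin using (Fin; zero; suc; toℕ; splitAt; _↑ˡ_; _↑ʳ_)
open import Data.Fin.Permutation using (Permutation; _⟨$⟩ʳ_)
open import Data.Fin.Properties using (_≟_; any?; pigeonhole; toℕ<n; splitAt-↑ˡ; splitAt-↑ʳ)
open import Data.List using (List; []; _∷_; _++_; map; mapMaybe; allFin; tabulate; length)
open import Data.List.Membership.Propositional using (_∈_)
open import Data.List.Membership.Propositional.Properties using (∈-++⁺ˡ; ∈-++⁺ʳ; ∈-map⁺; ∈-allFin)
open import Data.List.Properties using (map-tabulate; length-++; length-map; length-tabulate; length-mapMaybe)
open import Data.List.Relation.Unary.All as All using (All; [])
import Data.List.Relation.Unary.All.Properties as Allₚ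
import Data.List.Relation.Unary.Any as Any
import Data.List.Relation.Unary.Any.Properties as Anyₚ
open import Data.Maybe using (Maybe; just; nothing)
import Data.Maybe.Relation.Unary.All as MaybeAll
import Data.Maybe.Relation.Unary.Any as MaybeAny
open import Data.Nat
  using ( ℕ; zero; suc; _+_; _*_; _^_; _∸_; _≤_; _<_; _≤′_; ≤′-refl; ≤′-step; z≤n; s≤s; _≤?_
        ; >-nonZero; ⌈_/2⌉ )
open import Data.Nat.Induction using (<-rec)
open import Data.Nat.ListAction using () renaming (sum to listSum)
open import Data.Nat.Logarithm using (⌈log₂_⌉; ⌈log₂⌉-mono-≤; ⌈log₂⌈n/2⌉⌉≡⌈log₂n⌉∸1)
open import Data.Nat.Properties
  using ( +-0-commutativeMonoid; ≤-refl; ≤-reflexive; ≤-trans; ≤-total; ≤-pred; <⇒≤; ≰⇒>; ≤⇒≤′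
        ; +-assoc; +-comm; +-identityʳ; +-mono-≤; +-monoˡ-≤; +-monoʳ-≤; +-cancelʳ-≤
        ; *-mono-≤; *-monoʳ-≤; *-monoˡ-<; *-cancelˡ-≤; *-cancelˡ-<; ^-distribˡ-+-*
        ; n≤1+n; m≤m+n; m≤n+m; m+[n∸m]≡n; ⌊n/2⌋+⌈n/2⌉≡n; ⌊n/2⌋≤⌈n/2⌉; ⌈n/2⌉<n
        ; module ≤-Reasoning )
open import Data.Nat.Solver using (module +-*-Solver)
open import Algebra.Properties.CommutativeMonoid.Sum +-0-commutativeMonoid
  using (sum; sum-cong-≗; ∑-distrib-+; ∑-permute; sum-replicate-zero)
open import Data.Product using (Σ; ∃-syntax; _×_; _,_; proj₁; proj₂)
open import Data.Sum using (_⊎_; inj₁; inj₂; [_,_]′)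
open import Function using (_∘_; case_of_)
open import Function.Bundles using (Inverse; Bijection; _⤖_)
open import Function.Properties.Bijection using (⤖⇒↔)
open import Relation.Binary.PropositionalEquality
  using (_≡_; _≢_; _≗_; refl; sym; trans; cong; cong₂; subst; module ≡-Reasoning)
open import Relation.Nullary using (Dec; does; yes; no)
open import Relation.Nullary.Decidable using (dec-true; dec-false)

VertexSet : ℕ → Set
VertexSet n = Fin n → Bool

infixr 7 _∩_ _∖_

_∩_ : ∀ {n} → VertexSet n → VertexSet n → VertexSet n
(P ∩ S) x = P x ∧ S x

_∖_ : ∀ {n} → VertexSet n → VertexSet n → VertexSet n
(P ∖ S) x = P x ∧ not (S x)

witness : ∀ {A : Set} (a? : Dec A) → does a? ≡ true → A
witness (yes a) _ = a

=ᵇ-refl : ∀ {n} (x : Fin n) → (x =ᵇ x) ≡ true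
=ᵇ-refl x = dec-true (x ≟ x) refl

_∈ᵇ_ : ∀ {n} → Fin n → List (Fin n) → Bool
x ∈ᵇ L = does (Any.any? (x ≟_) L)

indicator : Bool → ℕ
indicator true  = 1
indicator false = 0

count : ∀ {n} → VertexSet n → ℕ
count P = sum (indicator ∘ P)

sum-mono-≤ : ∀ {n} {f g : Fin n → ℕ} → (∀ i → f i ≤ g i) → sum f ≤ sum g
sum-mono-≤ {zero}  f≤g = z≤n
sum-mono-≤ {suc n} f≤g = +-mono-≤ (f≤g zero) (sum-mono-≤ (f≤g ∘ suc))

module _ {n : ℕ} where

  count-cong : {P Q : VertexSet n} → P ≗ Q → count P ≡ count Q
  count-cong P≗Q = sum-cong-≗ (cong indicator ∘ P≗Q)

  count-∨ : (P Q : VertexSet n) → count (λ x → P x ∨ Q x) ≤ count P + count Q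
  count-∨ P Q = ≤-trans (sum-mono-≤ (λ x → indicator-∨ (P x) (Q x))) (≤-reflexive (∑-distrib-+ {n} _ _))
    where
    indicator-∨ : ∀ a b → indicator (a ∨ b) ≤ indicator a + indicator b
    indicator-∨ true  _     = s≤s z≤n
    indicator-∨ false _     = ≤-refl

  count-none : {P : VertexSet n} → (∀ x → P x ≡ false) → count P ≡ 0
  count-none P≡false = trans (count-cong P≡false) (sum-replicate-zero n)

  count-split : (P S : VertexSet n) → count P ≡ count (P ∩ S) + count (P ∖ S)
  count-split P S = trans pointwise (∑-distrib-+ {n} _ _)
    where
    indicator-split : ∀ a b → indicator a ≡ indicator (a ∧ b) + indicator (a ∧ not b)
    indicator-split true  true  = refl
    indicator-split true  false = refl
    indicator-split false _     = refl
    pointwise : count P ≡ sum (λ x → indicator ((P ∩ S) x) + indicator ((P ∖ S) x))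
    pointwise = sum-cong-≗ (λ x → indicator-split (P x) (S x))

count-≤ : ∀ {n} (P : VertexSet n) → count P ≤ n
count-≤ {zero}  P = z≤n
count-≤ {suc n} P = +-mono-≤ (indicator≤1 (P zero)) (count-≤ (P ∘ suc))
  where
  indicator≤1 : ∀ b → indicator b ≤ 1
  indicator≤1 true  = ≤-refl
  indicator≤1 false = z≤n

member⇒1≤count : ∀ {n} (P : VertexSet n) {x} → P x ≡ true → 1 ≤ count P
member⇒1≤count P {zero}  Px rewrite Px = s≤s z≤n
member⇒1≤count P {suc x} Px = ≤-trans (member⇒1≤count (P ∘ suc) Px) (m≤n+m _ _)

distinct⇒2≤count : ∀ {n} (P : VertexSet n) {x y} → P x ≡ true → P y ≡ true → x ≢ y → 2 ≤ count P
distinct⇒2≤count P {x} {y} Px Py x≢y =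
  ≤-trans (+-mono-≤ {1} {_} {1} at-x at-y) (≤-reflexive (sym (count-split P (_=ᵇ x))))
  where
  at-x : 1 ≤ count (P ∩ (_=ᵇ x))
  at-x = member⇒1≤count (P ∩ (_=ᵇ x)) (cong₂ _∧_ Px (=ᵇ-refl x))
  at-y : 1 ≤ count (P ∖ (_=ᵇ x))
  at-y = member⇒1≤count (P ∖ (_=ᵇ x)) (cong₂ _∧_ Py (cong not (dec-false (y ≟ x) (x≢y ∘ sym))))

count-singleton : ∀ {n} (a : Fin n) → count (_=ᵇ a) ≡ 1
count-singleton {suc n} zero    = cong suc (count-none {n} (λ _ → refl))
count-singleton {suc n} (suc a) = count-singleton a

count-∈ᵇ : ∀ {n} (L : List (Fin n)) → count (_∈ᵇ L) ≤ length L
count-∈ᵇ {n} []  = ≤-reflexive (count-none {n} (λ _ → refl))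
count-∈ᵇ (a ∷ L) = ≤-trans (count-∨ (_=ᵇ a) (_∈ᵇ L))
                          (+-mono-≤ (≤-reflexive (count-singleton a)) (count-∈ᵇ L))

count-++ : ∀ a b (Q : VertexSet (a + b)) → count Q ≡ count (Q ∘ (_↑ˡ b)) + count (Q ∘ (a ↑ʳ_))
count-++ zero    b Q = refl
count-++ (suc a) b Q = trans (cong (indicator (Q zero) +_) (count-++ a b (Q ∘ suc)))
                             (sym (+-assoc (indicator (Q zero)) _ _))

count-permute : ∀ {m n} (π : Permutation m n) (P : VertexSet n) → count P ≡ count (P ∘ (π ⟨$⟩ʳ_))
count-permute π P = ∑-permute (indicator ∘ P) π

outdeg≡count : ∀ {n} (H : Digraph n) v → outdeg H v ≡ count (H v)
outdeg≡count {n} H v = begin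
  listSum (map (λ u → if H v u then 1 else 0) (allFin n)) ≡⟨ cong listSum (map-tabulate {n = n} (λ u → u) _) ⟩
  listSum (tabulate (λ u → if H v u then 1 else 0))       ≡⟨ listSum-tabulate {n} _ ⟩
  sum (λ u → if H v u then 1 else 0)                      ≡⟨ sum-cong-≗ (if-indicator ∘ H v) ⟩
  count (H v)                                              ∎
  where
  open ≡-Reasoning
  if-indicator : ∀ b → (if b then 1 else 0) ≡ indicator b
  if-indicator true  = refl
  if-indicator false = refl
  listSum-tabulate : ∀ {m} (f : Fin m → ℕ) → listSum (tabulate f) ≡ sum f
  listSum-tabulate {zero}  f = refl
  listSum-tabulate {suc m} f = cong (f zero +_) (listSum-tabulate (f ∘ suc))

_[_] : ∀ {n} → Graph n → VertexSet n → Graph n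
G [ P ] = record
  { adj    = λ x y → adj G x y ∧ (P x ∧ P y)
  ; sym    = λ x y → cong₂ _∧_ (adj-sym G x y) (∧-comm (P x) (P y))
  ; irrefl = λ x → cong (_∧ (P x ∧ P x)) (irrefl G x)
  }

module _ {n : ℕ} {G : Graph n} {P : VertexSet n} {x y : Fin n} where

  induced-adj⁺ : adj G x y ≡ true → P x ≡ true → P y ≡ true → adj (G [ P ]) x y ≡ true
  induced-adj⁺ e Px Py = cong₂ _∧_ e (cong₂ _∧_ Px Py)

  induced-adj⁻ : adj (G [ P ]) x y ≡ true → adj G x y ≡ true × P x ≡ true × P y ≡ true
  induced-adj⁻ e = ∧-conicalˡ (adj G x y) _ e , ∧-conicalˡ (P x) (P y) inP , ∧-conicalʳ (P x) (P y) inP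
    where
    inP : (P x ∧ P y) ≡ true
    inP = ∧-conicalʳ (adj G x y) _ e

induced-mono : ∀ {n} {G : Graph n} {P Q : VertexSet n} → (∀ x → Q x ≡ true → P x ≡ true) →
               ∀ {x y} → adj (G [ Q ]) x y ≡ true → adj (G [ P ]) x y ≡ true
induced-mono {G = G} {P} {Q} Q⊆P {x} {y} e with induced-adj⁻ {G = G} {Q} e
... | e′ , Qx , Qy = induced-adj⁺ {G = G} {P} e′ (Q⊆P x Qx) (Q⊆P y Qy)

module _ {n : ℕ} where

  Walk-map : {G G′ : Graph n} → (∀ {x y} → adj G x y ≡ true → adj G′ x y ≡ true) →
             ∀ {u v ℓ} → Walk G u v ℓ → Walk G′ u v ℓ
  Walk-map f stay       = stay
  Walk-map f (step e W) = step (f e) (Walk-map f W)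

  module _ {G : Graph n} where

    Walk-snoc : ∀ {u v w ℓ} → Walk G u v ℓ → adj G v w ≡ true → Walk G u w (suc ℓ)
    Walk-snoc stay       e = step e stay
    Walk-snoc (step e′ W) e = step e′ (Walk-snoc W e)

    Walk-reverse : ∀ {u v ℓ} → Walk G u v ℓ → Walk G v u ℓ
    Walk-reverse stay                  = stay
    Walk-reverse (step {u} {w} e W) = Walk-snoc (Walk-reverse W) (trans (adj-sym G w u) e)

  walk⇒2≤count : {G : Graph n} {P : VertexSet n} → ∀ {u v ℓ} → Walk (G [ P ]) u v (suc ℓ) → 2 ≤ count P
  walk⇒2≤count {G} {P} (step {u} {w} e _) with induced-adj⁻ {G = G} {P} e
  ... | e′ , Pu , Pw = distinct⇒2≤count P Pu Pw λ { refl → case trans (sym e′) (irrefl G u) of λ () }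

module _ {n : ℕ} {G : Graph n} where

  vertexAt : ∀ {u v ℓ} → Walk G u v ℓ → Fin (suc ℓ) → Fin n
  vertexAt {u} W          zero    = u
  vertexAt     (step e W) (suc i) = vertexAt W i

  Walk-take : ∀ {u v ℓ} (W : Walk G u v ℓ) i → Walk G u (vertexAt W i) (toℕ i)
  Walk-take W          zero    = stay
  Walk-take (step e W) (suc i) = step e (Walk-take W i)

  Walk-drop : ∀ {u v ℓ} (W : Walk G u v ℓ) i → Walk G (vertexAt W i) v (ℓ ∸ toℕ i)
  Walk-drop W          zero    = W
  Walk-drop (step e W) (suc i) = Walk-drop W i

  _++ʷ_ : ∀ {u w v a b} → Walk G u w a → Walk G w v b → Walk G u v (a + b)
  stay     ++ʷ W′ = W′
  step e W ++ʷ W′ = step e (W ++ʷ W′)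

  Walk-shorten : ∀ {u v ℓ} → Walk G u v ℓ → n ≤ ℓ → ∃[ ℓ′ ] (ℓ′ < ℓ × Walk G u v ℓ′)
  Walk-shorten {v = v} {ℓ} W n≤ℓ with pigeonhole (s≤s n≤ℓ) (vertexAt W)
  ... | i , j , i<j , same =
    toℕ i + (ℓ ∸ toℕ j) , shorter ,
    Walk-take W i ++ʷ subst (λ x → Walk G x v (ℓ ∸ toℕ j)) (sym same) (Walk-drop W j)
    where
    shorter : toℕ i + (ℓ ∸ toℕ j) < ℓ
    shorter = ≤-trans (+-monoˡ-≤ (ℓ ∸ toℕ j) i<j) (≤-reflexive (m+[n∸m]≡n (≤-pred (toℕ<n j))))

  Dist⇒< : ∀ {u v ℓ} → Dist G u v ℓ → ℓ < n
  Dist⇒< {ℓ = ℓ} (W , shortest) with n ≤? ℓ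
  ... | no  n≰ℓ = ≰⇒> n≰ℓ
  ... | yes n≤ℓ with Walk-shorten W n≤ℓ
  ...   | ℓ′ , ℓ′<ℓ , W′ = ⊥-elim (shortest ℓ′ ℓ′<ℓ W′)

-- Walking towards a target set

InBall-mono : ∀ {n} {H : Digraph n} {v a b x} → a ≤ b → InBall H v a x → InBall H v b x
InBall-mono a≤b       here          = here
InBall-mono (s≤s a≤b) (there e x∈B) = there e (InBall-mono a≤b x∈B)

module Approach {n : ℕ} (G : Graph n) (M : VertexSet n) where

  mutual
    Near : ℕ → VertexSet n
    Near zero    w = M w
    Near (suc r) w = Near r w ∨ does (closer? r w)

    closer? : ∀ r w → Dec (∃[ w′ ] ((adj G w w′ ∧ Near r w′) ≡ true))
    closer? r w = any? λ w′ → (adj G w w′ ∧ Near r w′) Bool.≟ true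

  -- hop r w: the first step of a shortest walk from w into M, provided there is one of length ≤ r
  hop : ℕ → Fin n → Maybe (Fin n)
  hop zero    w = nothing
  hop (suc r) w with Near r w | closer? r w
  ... | true  | _            = hop r w
  ... | false | yes (w′ , _) = just w′
  ... | false | no _         = nothing

  hop-adj : ∀ r w → MaybeAll.All (λ w′ → adj G w w′ ≡ true) (hop r w)
  hop-adj zero    w = MaybeAll.nothing
  hop-adj (suc r) w with Near r w | closer? r w
  ... | true  | _            = hop-adj r w
  ... | false | yes (w′ , e) = MaybeAll.just (∧-conicalˡ (adj G w w′) _ e)
  ... | false | no _         = MaybeAll.nothing

  hop-just-adj : ∀ {r w w′} → hop r w ≡ just w′ → adj G w w′ ≡ true
  hop-just-adj {r} {w} hop≡ = MaybeAll.drop-just (subst (MaybeAll.All _) hop≡ (hop-adj r w))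

  hop-suc : ∀ {r w} → Near r w ≡ true → hop (suc r) w ≡ hop r w
  hop-suc {r} {w} near with Near r w | closer? r w
  ... | true | _ = refl

  hop-step : ∀ {r w} → Near (suc r) w ≡ true →
             Near r w ≡ true ⊎ ∃[ w′ ] (hop (suc r) w ≡ just w′ × Near r w′ ≡ true)
  hop-step {r} {w} near with Near r w | closer? r w
  ... | true  | _            = inj₁ refl
  ... | false | yes (w′ , e) = inj₂ (w′ , refl , ∧-conicalʳ (adj G w w′) _ e)

  Near-≤ : ∀ {r R w} → r ≤′ R → Near r w ≡ true → Near R w ≡ true
  Near-≤ ≤′-refl        near = near
  Near-≤ {R = suc R} {w} (≤′-step r≤′R) near = cong (_∨ does (closer? R w)) (Near-≤ r≤′R near)

  hop-≤ : ∀ {r R w} → r ≤′ R → Near r w ≡ true → hop R w ≡ hop r w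
  hop-≤ ≤′-refl        near = refl
  hop-≤ {R = suc R} (≤′-step r≤′R) near = trans (hop-suc {R} (Near-≤ r≤′R near)) (hop-≤ r≤′R near)

  Near-walk : ∀ {u x r} → Walk G u x r → M x ≡ true → Near r u ≡ true
  Near-walk stay Mx = Mx
  Near-walk {u} {r = suc r} (step {w = w} e W) Mx =
    trans (cong (Near r u ∨_) (dec-true (closer? r u) (w , cong₂ _∧_ e (Near-walk W Mx)))) (∨-zeroʳ (Near r u))

  module _ (N : ℕ) (H : Digraph n) (hop⊆H : ∀ {w w′} → hop N w ≡ just w′ → H w w′ ≡ true) where

    reach : ∀ {r w} → r ≤ N → Near r w ≡ true → ∃[ x ] (M x ≡ true × InBall H w r x)
    reach {zero}  {w} _   Mw   = w , Mw , here
    reach {suc r} {w} r<N near with hop-step {r} near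
    ... | inj₁ near′ with reach (<⇒≤ r<N) near′
    ...   | x , Mx , x∈B = x , Mx , InBall-mono (n≤1+n r) x∈B
    reach {suc r} {w} r<N near | inj₂ (w′ , hop-w , near′) with reach (<⇒≤ r<N) near′
    ...   | x , Mx , x∈B = x , Mx , there (hop⊆H (trans (hop-≤ {suc r} (≤⇒≤′ r<N) near) hop-w)) x∈B

-- Guidance across a twin cut

module _ {n : ℕ} (G : Graph n) where

  Guided : Digraph n → Fin n → Fin n → ℕ → Set
  Guided H u v ℓ = ∃[ a ] ∃[ b ] (suc (a + b) ≡ ℓ ×
                     ∃[ x ] ∃[ y ] (InBall H u a x × InBall H v b y × adj G x y ≡ true))

  Guided-sym : ∀ {H u v ℓ} → Guided H u v ℓ → Guided H v u ℓ
  Guided-sym (a , b , a+b , x , y , x∈B , y∈B , xy) =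
    b , a , trans (cong suc (+-comm b a)) a+b , y , x , y∈B , x∈B , trans (adj-sym G y x) xy

  record Crossing (u v : Fin n) (ℓ : ℕ) : Set where
    constructor crossing
    field
      {p q}          : Fin n
      {before after} : ℕ
      prefix : Walk G u p before
      bridge : adj G p q ≡ true
      suffix : Walk G q v after
      total  : suc (before + after) ≡ ℓ

  Crossing-reverse : ∀ {u v ℓ} → Crossing u v ℓ → Crossing v u ℓ
  Crossing-reverse (crossing {p} {q} {a} {b} W e W′ eq) =
    crossing (Walk-reverse W′) (trans (adj-sym G q p) e) (Walk-reverse W) (trans (cong suc (+-comm b a)) eq)

  Crossing-step : ∀ {u w v ℓ} → adj G u w ≡ true → Crossing w v ℓ → Crossing u v (suc ℓ)
  Crossing-step e (crossing W e′ W′ eq) = crossing (step e W) e′ W′ (cong suc eq)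

module _ {n : ℕ} {G : Graph n} {P : VertexSet n} (S : VertexSet n) where

  open Crossing

  data Route (u v : Fin n) (ℓ : ℕ) : Set where
    stays-in  : S u ≡ true  → Walk (G [ P ∩ S ]) u v ℓ → Route u v ℓ
    stays-out : S u ≡ false → Walk (G [ P ∖ S ]) u v ℓ → Route u v ℓ
    exits     : (c : Crossing (G [ P ]) u v ℓ) → S (p c) ≡ true  → S (q c) ≡ false → Route u v ℓ
    enters    : (c : Crossing (G [ P ]) u v ℓ) → S (p c) ≡ false → S (q c) ≡ true  → Route u v ℓ

  private
    widen : ∀ {Q : VertexSet n} → (∀ x → Q x ≡ true → P x ≡ true) →
            ∀ {u v ℓ} → Walk (G [ Q ]) u v ℓ → Walk (G [ P ]) u v ℓ
    widen {Q} Q⊆P = Walk-map (induced-mono {G = G} {P} {Q} Q⊆P)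

  route : ∀ {u v ℓ} → Walk (G [ P ]) u v ℓ → Route u v ℓ
  route {u} stay with S u in Su
  ... | true  = stays-in Su stay
  ... | false = stays-out Su stay
  route {u} (step e W) with route W | induced-adj⁻ {G = G} {P} e
  ... | exits  c Sp Sq | _ = exits  (Crossing-step (G [ P ]) e c) Sp Sq
  ... | enters c Sp Sq | _ = enters (Crossing-step (G [ P ]) e c) Sp Sq
  ... | stays-in Sw W∩ | e′ , Pu , Pw with S u in Su
  ...   | true  = stays-in Su (step (induced-adj⁺ {G = G} e′ (cong₂ _∧_ Pu Su) (cong₂ _∧_ Pw Sw)) W∩)
  ...   | false = enters (crossing stay e (widen (λ x → ∧-conicalˡ (P x) (S x)) W∩) refl) Su Sw
  route {u} (step e W) | stays-out Sw W∖ | e′ , Pu , Pw with S u in Su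
  ...   | false =
    stays-out Su (step (induced-adj⁺ {G = G} e′ (cong₂ _∧_ Pu (cong not Su)) (cong₂ _∧_ Pw (cong not Sw))) W∖)
  ...   | true  = exits (crossing stay e (widen (λ x → ∧-conicalˡ (P x) (not (S x))) W∖) refl) Su Sw

record TwinCut {n} (E : Fin n → Fin n → Bool) (k : ℕ) : Set where
  field
    inside : VertexSet n
    colour : Fin n → Fin k
    twins  : ∀ {x x′ y} → inside x ≡ true → inside x′ ≡ true → inside y ≡ false →
             colour x ≡ colour x′ → E x y ≡ E x′ y

module Targets {n k : ℕ} (G : Graph n) (c : TwinCut (adj G) k) where

  open TwinCut c

  coloured : Fin k → VertexSet n
  coloured i x = inside x ∧ (colour x =ᵇ i)

  attached : Fin k → VertexSet n
  attached i y = not (inside y) ∧ does (any? λ x → (coloured i x ∧ adj G x y) Bool.≟ true)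

  targets : List (VertexSet n)
  targets = map coloured (allFin k) ++ map attached (allFin k)

  length-targets : length targets ≡ k + k
  length-targets =
    trans (length-++ (map coloured (allFin k))) (cong₂ _+_ (length-map-allFin coloured) (length-map-allFin attached))
    where
    length-map-allFin : (f : Fin k → VertexSet n) → length (map f (allFin k)) ≡ k
    length-map-allFin f = trans (length-map f (allFin k)) (length-tabulate {n = k} (λ i → i))

  coloured-class : ∀ {i z} → coloured i z ≡ true → inside z ≡ true × colour z ≡ i
  coloured-class {i} {z} Mz = ∧-conicalˡ (inside z) _ Mz , witness (colour z ≟ i) (∧-conicalʳ (inside z) _ Mz)

  attached-class : ∀ {i y} → attached i y ≡ true →
                   inside y ≡ false × ∃[ x ] ((coloured i x ∧ adj G x y) ≡ true)
  attached-class {i} {y} Ay =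
    not-injective (∧-conicalˡ (not (inside y)) _ Ay) ,
    witness (any? λ x → (coloured i x ∧ adj G x y) Bool.≟ true) (∧-conicalʳ (not (inside y)) _ Ay)

  coloured-adj-attached : ∀ {i x y} → coloured i x ≡ true → attached i y ≡ true → adj G x y ≡ true
  coloured-adj-attached {i} {x} {y} Mx Ay with coloured-class Mx | attached-class Ay
  ... | Sx , x∈i | Sy , x′ , Mx′∧x′y with coloured-class (∧-conicalˡ (coloured i x′) _ Mx′∧x′y)
  ...   | Sx′ , x′∈i = trans (twins Sx Sx′ Sy (trans x∈i (sym x′∈i))) (∧-conicalʳ (coloured i x′) _ Mx′∧x′y)

  bridge-classes : ∀ {p q} → inside p ≡ true → inside q ≡ false → adj G p q ≡ true →
                   coloured (colour p) p ≡ true × attached (colour p) q ≡ true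
  bridge-classes {p} Sp Sq e =
    Mp , cong₂ _∧_ (cong not Sq) (dec-true (any? _) (p , cong₂ _∧_ Mp e))
    where
    Mp = cong₂ _∧_ Sp (=ᵇ-refl (colour p))

  coloured∈targets : ∀ i → coloured i ∈ targets
  coloured∈targets i = ∈-++⁺ˡ (∈-map⁺ coloured (∈-allFin i))

  attached∈targets : ∀ i → attached i ∈ targets
  attached∈targets i = ∈-++⁺ʳ (map coloured (allFin k)) (∈-map⁺ attached (∈-allFin i))

  module _ (P : VertexSet n) (N : ℕ) (H : Digraph n)
           (hop⊆H : ∀ {M} → M ∈ targets →
                    ∀ {w w′} → Approach.hop (G [ P ]) M N w ≡ just w′ → H w w′ ≡ true)
           where

    open Approach (G [ P ]) using (Near; Near-walk)

    reach-target : ∀ {M} → M ∈ targets → ∀ {r w} → r ≤ N → Near M r w ≡ true →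
                   ∃[ x ] (M x ≡ true × InBall H w r x)
    reach-target M∈ = Approach.reach (G [ P ]) _ N H (hop⊆H M∈)

    crossing-guided : ∀ {u v ℓ} (c : Crossing (G [ P ]) u v ℓ) → inside (Crossing.p c) ≡ true →
                      inside (Crossing.q c) ≡ false → ℓ ≤ N → Guided G H u v ℓ
    crossing-guided (crossing {p} {q} {a} {b} W e W′ a+b) Sp Sq ℓ≤N =
      let Mp , Aq        = bridge-classes Sp Sq (proj₁ (induced-adj⁻ {G = G} {P} e))
          x , Mx , x∈B   = reach-target (coloured∈targets (colour p)) a≤N (Near-walk _ W Mp)
          y , Ay , y∈B   = reach-target (attached∈targets (colour p)) b≤N (Near-walk _ (Walk-reverse W′) Aq)
      in a , b , a+b , x , y , x∈B , y∈B , coloured-adj-attached Mx Ay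
      where
      a≤N : a ≤ N
      a≤N = ≤-trans (m≤m+n a b) (≤-trans (n≤1+n _) (≤-trans (≤-reflexive a+b) ℓ≤N))
      b≤N : b ≤ N
      b≤N = ≤-trans (m≤n+m b a) (≤-trans (n≤1+n _) (≤-trans (≤-reflexive a+b) ℓ≤N))

-- Recursive balanced cuts

∈-mapMaybe⁺ : ∀ {A B : Set} (f : A → Maybe B) {x y xs} → x ∈ xs → f x ≡ just y → y ∈ mapMaybe f xs
∈-mapMaybe⁺ f {xs = xs} x∈xs fx =
  Anyₚ.mapMaybe⁺ f xs (Anyₚ.map⁺ (Any.map (λ { refl → subst (MaybeAny.Any _) (sym fx) (MaybeAny.just refl) })
                                           x∈xs))

Balanced : ∀ {n} → VertexSet n → VertexSet n → Set
Balanced P S = 3 * count (P ∩ S) ≤ 2 * count P × 3 * count (P ∖ S) ≤ 2 * count P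

-- The arcs need a cut for every P, but it can only be balanced when |P| ≥ 2.
BalancedCuts : ∀ {n} → Graph n → ℕ → Set
BalancedCuts G k = ∀ P → ∃[ c ] (2 ≤ count P → Balanced P (TwinCut.inside {E = adj G} {k} c))

shrink : ∀ {a b} d → 3 * a ≤ 2 * b → 2 ^ suc d * b ≤ 3 ^ suc d → 2 ^ d * a ≤ 3 ^ d
shrink {a} {b} d 3a≤2b bound = *-cancelˡ-≤ 3 (begin
  3 * (2 ^ d * a)  ≡⟨ solve 2 (λ x a → con 3 :* (x :* a) := x :* (con 3 :* a)) refl (2 ^ d) a ⟩
  2 ^ d * (3 * a)  ≤⟨ *-monoʳ-≤ (2 ^ d) 3a≤2b ⟩
  2 ^ d * (2 * b)  ≡⟨ solve 2 (λ x b → x :* (con 2 :* b) := (con 2 :* x) :* b) refl (2 ^ d) b ⟩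
  2 ^ suc d * b    ≤⟨ bound ⟩
  3 ^ suc d        ∎)
  where
  open ≤-Reasoning
  open +-*-Solver

module Construction {n k : ℕ} (G : Graph n) (cuts : BalancedCuts G k) (N : ℕ) where

  open TwinCut

  cutOf : VertexSet n → TwinCut (adj G) k
  cutOf P = proj₁ (cuts P)

  levelArcs : VertexSet n → Fin n → List (Fin n)
  levelArcs P w = mapMaybe (λ M → Approach.hop (G [ P ]) M N w) (Targets.targets G (cutOf P))

  inner outer : VertexSet n → VertexSet n
  inner P = P ∩ inside (cutOf P)
  outer P = P ∖ inside (cutOf P)

  sideOf : VertexSet n → Fin n → VertexSet n
  sideOf P w = if inside (cutOf P) w then inner P else outer P

  cut-balanced : ∀ {P u v ℓ} → Walk (G [ P ]) u v (suc ℓ) → Balanced P (inside (cutOf P))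
  cut-balanced {P} W = proj₂ (cuts P) (walk⇒2≤count {G = G} {P} W)

  arcs : ℕ → VertexSet n → Fin n → List (Fin n)
  arcs zero    P w = []
  arcs (suc d) P w = levelArcs P w ++ arcs d (sideOf P w) w

  arcs-length : ∀ d P w → length (arcs d P w) ≤ d * (k + k)
  arcs-length zero    P w = z≤n
  arcs-length (suc d) P w = begin
    length (levelArcs P w ++ arcs d (sideOf P w) w)      ≡⟨ length-++ (levelArcs P w) ⟩
    length (levelArcs P w) + length (arcs d (sideOf P w) w) ≤⟨ +-mono-≤ level (arcs-length d (sideOf P w) w) ⟩
    (k + k) + d * (k + k)                                   ∎
    where
    open ≤-Reasoning
    level : length (levelArcs P w) ≤ k + k
    level = ≤-trans (length-mapMaybe _ (Targets.targets G (cutOf P))) (≤-reflexive (Targets.length-targets G (cutOf P)))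

  arcs-adj : ∀ d P w → All (λ w′ → adj G w w′ ≡ true) (arcs d P w)
  arcs-adj zero    P w = []
  arcs-adj (suc d) P w =
    Allₚ.++⁺ (Allₚ.mapMaybe⁺ {xs = targets} (Allₚ.map⁺ (All.universal hop-adj targets)))
             (arcs-adj d (sideOf P w) w)
    where
    targets = Targets.targets G (cutOf P)
    hop-adj : ∀ M → MaybeAll.All (λ w′ → adj G w w′ ≡ true) (Approach.hop (G [ P ]) M N w)
    hop-adj M = MaybeAll.map (proj₁ ∘ induced-adj⁻ {G = G} {P}) (Approach.hop-adj (G [ P ]) M N w)

  Covers : ℕ → VertexSet n → Digraph n → Set
  Covers d P H = ∀ {w w′} → P w ≡ true → w′ ∈ arcs d P w → H w w′ ≡ true

  module _ {d : ℕ} {P : VertexSet n} {H : Digraph n} (cov : Covers (suc d) P H) where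

    Covers-side : ∀ {Q} → (∀ {w} → Q w ≡ true → P w ≡ true × sideOf P w ≡ Q) → Covers d Q H
    Covers-side side Qw w′∈ with side Qw
    ... | Pw , refl = cov Pw (∈-++⁺ʳ _ w′∈)

    Covers-inner : Covers d (inner P) H
    Covers-inner = Covers-side λ {w} PSw →
      ∧-conicalˡ (P w) _ PSw , cong (if_then inner P else outer P) (∧-conicalʳ (P w) _ PSw)

    Covers-outer : Covers d (outer P) H
    Covers-outer = Covers-side λ {w} PSw →
      ∧-conicalˡ (P w) _ PSw , cong (if_then inner P else outer P) (not-injective (∧-conicalʳ (P w) _ PSw))

    Covers-hops : ∀ {M} → M ∈ Targets.targets G (cutOf P) →
                  ∀ {w w′} → Approach.hop (G [ P ]) M N w ≡ just w′ → H w w′ ≡ true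
    Covers-hops {M} M∈ hop≡ =
      cov (proj₁ (proj₂ (induced-adj⁻ {G = G} {P} (Approach.hop-just-adj (G [ P ]) M {N} hop≡))))
          (∈-++⁺ˡ (∈-mapMaybe⁺ _ M∈ hop≡))

  -- the bound on count P says that d further balanced cuts leave fewer than two vertices
  guided : ∀ d P → 2 ^ d * count P ≤ 3 ^ d → ∀ {H} → Covers d P H →
           ∀ {u v ℓ} → Walk (G [ P ]) u v (suc ℓ) → suc ℓ ≤ N → Guided G H u v (suc ℓ)
  guided zero P bound cov W _ with ≤-trans (walk⇒2≤count {G = G} {P} W) (≤-trans (m≤m+n (count P) 0) bound)
  ... | s≤s ()
  guided (suc d) P bound {H} cov W ℓ≤N with route {G = G} {P} (inside (cutOf P)) W
  ... | stays-in  _ W′ =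
    guided d (inner P) (shrink d (proj₁ (cut-balanced W)) bound) (Covers-inner {d} {P} cov) W′ ℓ≤N
  ... | stays-out _ W′ =
    guided d (outer P) (shrink d (proj₂ (cut-balanced W)) bound) (Covers-outer {d} {P} cov) W′ ℓ≤N
  ... | exits  c Sp Sq = Targets.crossing-guided G (cutOf P) P N H (Covers-hops {d} {P} cov) c Sp Sq ℓ≤N
  ... | enters c Sp Sq =
    Guided-sym G (Targets.crossing-guided G (cutOf P) P N H (Covers-hops {d} {P} cov) (Crossing-reverse _ c) Sq Sp ℓ≤N)

weakGuidance-of-balancedCuts : ∀ {n k} (G : Graph n) → BalancedCuts G k → ∀ d → 2 ^ d * n ≤ 3 ^ d →
  ∃[ H ] (IsPartialOrientation G H × (∀ v → outdeg H v ≤ d * (k + k)) × WeakGuidance G H)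
weakGuidance-of-balancedCuts {n} {k} G cuts d bound = H , orientation , degree , guidance
  where
  open Construction G cuts n

  everything : VertexSet n
  everything _ = true

  H : Digraph n
  H v w = w ∈ᵇ arcs d everything v

  orientation : IsPartialOrientation G H
  orientation u w Huw = All.lookup (arcs-adj d everything u) (witness (Any.any? (w ≟_) _) Huw)

  degree : ∀ v → outdeg H v ≤ d * (k + k)
  degree v = begin
    outdeg H v                        ≡⟨ outdeg≡count H v ⟩
    count (_∈ᵇ arcs d everything v)   ≤⟨ count-∈ᵇ (arcs d everything v) ⟩
    length (arcs d everything v)      ≤⟨ arcs-length d everything v ⟩
    d * (k + k)                       ∎
    where open ≤-Reasoning

  guidance : WeakGuidance G H
  guidance u v zero    u≢v (stay , _) = ⊥-elim (u≢v refl)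
  guidance u v (suc ℓ) _   dist       =
    guided d everything (≤-trans (*-monoʳ-≤ (2 ^ d) (count-≤ everything)) bound)
           (λ {w} {w′} _ w′∈ → dec-true (Any.any? (w′ ≟_) (arcs d everything w)) w′∈)
           (Walk-map (λ e → induced-adj⁺ {G = G} {everything} e refl refl) (proj₁ dist)) (<⇒≤ (Dist⇒< dist))

-- Balanced cuts from clique-width expressions

Between : ℕ → ℕ → Set
Between c w = c ≤ 3 * w × 3 * w ≤ 2 * c

heavier-part : ∀ {c a b} → 2 * c < 3 * (a + b) → b ≤ a → c < 3 * a
heavier-part {c} {a} {b} 2c<3[a+b] b≤a = *-cancelˡ-< 2 c (3 * a) (begin-strict
  2 * c        <⟨ 2c<3[a+b] ⟩
  3 * (a + b)  ≤⟨ *-monoʳ-≤ 3 (+-monoʳ-≤ a b≤a) ⟩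
  3 * (a + a)  ≡⟨ solve 1 (λ a → con 3 :* (a :+ a) := con 2 :* (con 3 :* a)) refl a ⟩
  2 * (3 * a)  ∎)
  where
  open ≤-Reasoning
  open +-*-Solver

one-part-heavy : ∀ {c a b} → 2 * c < 3 * (a + b) → c < 3 * a ⊎ c < 3 * b
one-part-heavy {c} {a} {b} 2c<3[a+b] with ≤-total b a
... | inj₁ b≤a = inj₁ (heavier-part 2c<3[a+b] b≤a)
... | inj₂ a≤b = inj₂ (heavier-part (subst (λ s → 2 * c < 3 * s) (+-comm a b) 2c<3[a+b]) a≤b)

-- The vertices of a subexpression, coloured by their labels there.  Coherence (equal colours
-- end up with equal labels) is what preserves the twin property through the joins above it.
record SubexpressionCut {k} (t : CWExpr k) : Set where
  field
    cut      : TwinCut (edge t) k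
  open TwinCut cut public
  field
    coherent : ∀ {x x′} → inside x ≡ true → inside x′ ≡ true → colour x ≡ colour x′ →
               label t x ≡ label t x′

module _ {k : ℕ} where

  open SubexpressionCut

  whole : (t : CWExpr k) → SubexpressionCut t
  whole t = record
    { cut      = record { inside = λ _ → true ; colour = label t ; twins = λ { _ _ () _ } }
    ; coherent = λ _ _ same → same
    }

  ⊕-left : ∀ {a} b → SubexpressionCut a → SubexpressionCut (a ⊕ b)
  ⊕-left {a} b K = record
    { cut      = record { inside = inside′ ; colour = colour′ ; twins = twins′ }
    ; coherent = coherent′
    }
    where
    inside′ : VertexSet (size (a ⊕ b))
    inside′ x = [ inside K , (λ _ → false) ]′ (splitAt (size a) x)
    colour′ : Fin (size (a ⊕ b)) → Fin k
    colour′ x = [ colour K , label b ]′ (splitAt (size a) x)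
    twins′ : ∀ {x x′ y} → inside′ x ≡ true → inside′ x′ ≡ true → inside′ y ≡ false →
             colour′ x ≡ colour′ x′ → edge (a ⊕ b) x y ≡ edge (a ⊕ b) x′ y
    twins′ {x} {x′} {y} Sx Sx′ Sy same with splitAt (size a) x | splitAt (size a) x′ | splitAt (size a) y
    ... | inj₁ _ | inj₁ _ | inj₁ _ = twins K Sx Sx′ Sy same
    ... | inj₁ _ | inj₁ _ | inj₂ _ = refl
    coherent′ : ∀ {x x′} → inside′ x ≡ true → inside′ x′ ≡ true → colour′ x ≡ colour′ x′ →
                label (a ⊕ b) x ≡ label (a ⊕ b) x′
    coherent′ {x} {x′} Sx Sx′ same with splitAt (size a) x | splitAt (size a) x′
    ... | inj₁ _ | inj₁ _ = coherent K Sx Sx′ same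

  ⊕-right : ∀ a {b} → SubexpressionCut b → SubexpressionCut (a ⊕ b)
  ⊕-right a {b} K = record
    { cut      = record { inside = inside′ ; colour = colour′ ; twins = twins′ }
    ; coherent = coherent′
    }
    where
    inside′ : VertexSet (size (a ⊕ b))
    inside′ x = [ (λ _ → false) , inside K ]′ (splitAt (size a) x)
    colour′ : Fin (size (a ⊕ b)) → Fin k
    colour′ x = [ label a , colour K ]′ (splitAt (size a) x)
    twins′ : ∀ {x x′ y} → inside′ x ≡ true → inside′ x′ ≡ true → inside′ y ≡ false →
             colour′ x ≡ colour′ x′ → edge (a ⊕ b) x y ≡ edge (a ⊕ b) x′ y
    twins′ {x} {x′} {y} Sx Sx′ Sy same with splitAt (size a) x | splitAt (size a) x′ | splitAt (size a) y
    ... | inj₂ _ | inj₂ _ | inj₂ _ = twins K Sx Sx′ Sy same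
    ... | inj₂ _ | inj₂ _ | inj₁ _ = refl
    coherent′ : ∀ {x x′} → inside′ x ≡ true → inside′ x′ ≡ true → colour′ x ≡ colour′ x′ →
                label (a ⊕ b) x ≡ label (a ⊕ b) x′
    coherent′ {x} {x′} Sx Sx′ same with splitAt (size a) x | splitAt (size a) x′
    ... | inj₂ _ | inj₂ _ = coherent K Sx Sx′ same

  relab-cut : ∀ (i j : Fin k) {t : CWExpr k} → SubexpressionCut t → SubexpressionCut (relab i j t)
  relab-cut i j K = record
    { cut      = cut K
    ; coherent = λ Sx Sx′ same → cong (λ l → if l =ᵇ i then j else l) (coherent K Sx Sx′ same)
    }

  join-cut : ∀ (i j : Fin k) {t : CWExpr k} → SubexpressionCut t → SubexpressionCut (join i j t)
  join-cut i j {t} K = record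
    { cut      = record { inside = inside K ; colour = colour K ; twins = twins′ }
    ; coherent = coherent K
    }
    where
    distinct : ∀ {x y} → inside K x ≡ true → inside K y ≡ false → (x =ᵇ y) ≡ false
    distinct {x} {y} Sx Sy = dec-false (x ≟ y) λ { refl → case trans (sym Sx) Sy of λ () }
    twins′ : ∀ {x x′ y} → inside K x ≡ true → inside K x′ ≡ true → inside K y ≡ false →
             colour K x ≡ colour K x′ → edge (join i j t) x y ≡ edge (join i j t) x′ y
    twins′ Sx Sx′ Sy same
      rewrite twins K Sx Sx′ Sy same | distinct Sx Sy | distinct Sx′ Sy | coherent K Sx Sx′ same = refl

  weight : ∀ {t : CWExpr k} → VertexSet (size t) → SubexpressionCut t → ℕ
  weight Q K = count (Q ∩ inside K)

  weight-whole : ∀ {t : CWExpr k} (Q : VertexSet (size t)) → weight Q (whole t) ≡ count Q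
  weight-whole Q = count-cong (∧-identityʳ ∘ Q)

  weight-⊕-left : ∀ {a : CWExpr k} b (Q : VertexSet (size a + size b)) (K : SubexpressionCut a) →
                  weight Q (⊕-left b K) ≡ weight (Q ∘ (_↑ˡ size b)) K
  weight-⊕-left {a} b Q K = begin
    weight Q (⊕-left b K)                                            ≡⟨ count-++ (size a) (size b) (Q ∩ S) ⟩
    count ((Q ∩ S) ∘ (_↑ˡ size b)) + count ((Q ∩ S) ∘ (size a ↑ʳ_))  ≡⟨ cong₂ _+_ (count-cong left) (count-none right) ⟩
    weight (Q ∘ (_↑ˡ size b)) K + 0                                  ≡⟨ +-identityʳ _ ⟩
    weight (Q ∘ (_↑ˡ size b)) K                                      ∎
    where
    open ≡-Reasoning
    S = inside (⊕-left b K)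
    left : ∀ i → Q (i ↑ˡ size b) ∧ S (i ↑ˡ size b) ≡ Q (i ↑ˡ size b) ∧ inside K i
    left i = cong (λ z → Q (i ↑ˡ size b) ∧ [ inside K , (λ _ → false) ]′ z) (splitAt-↑ˡ (size a) i (size b))
    right : ∀ i → Q (size a ↑ʳ i) ∧ S (size a ↑ʳ i) ≡ false
    right i = trans (cong (λ z → Q (size a ↑ʳ i) ∧ [ inside K , (λ _ → false) ]′ z) (splitAt-↑ʳ (size a) (size b) i))
                    (∧-zeroʳ _)

  weight-⊕-right : ∀ a {b : CWExpr k} (Q : VertexSet (size a + size b)) (K : SubexpressionCut b) →
                   weight Q (⊕-right a K) ≡ weight (Q ∘ (size a ↑ʳ_)) K
  weight-⊕-right a {b} Q K = begin
    weight Q (⊕-right a K)                                           ≡⟨ count-++ (size a) (size b) (Q ∩ S) ⟩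
    count ((Q ∩ S) ∘ (_↑ˡ size b)) + count ((Q ∩ S) ∘ (size a ↑ʳ_))  ≡⟨ cong₂ _+_ (count-none left) (count-cong right) ⟩
    weight (Q ∘ (size a ↑ʳ_)) K                                      ∎
    where
    open ≡-Reasoning
    S = inside (⊕-right a K)
    left : ∀ i → Q (i ↑ˡ size b) ∧ S (i ↑ˡ size b) ≡ false
    left i = trans (cong (λ z → Q (i ↑ˡ size b) ∧ [ (λ _ → false) , inside K ]′ z) (splitAt-↑ˡ (size a) i (size b)))
                   (∧-zeroʳ _)
    right : ∀ i → Q (size a ↑ʳ i) ∧ S (size a ↑ʳ i) ≡ Q (size a ↑ʳ i) ∧ inside K i
    right i = cong (λ z → Q (size a ↑ʳ i) ∧ [ (λ _ → false) , inside K ]′ z) (splitAt-↑ʳ (size a) (size b) i)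

  BalancedPart : ∀ t → VertexSet (size t) → ℕ → Set
  BalancedPart t Q c = Σ (SubexpressionCut t) λ K → Between c (weight Q K)

  part-or-whole : ∀ {s t : CWExpr k} {Qs : VertexSet (size s)} {Q : VertexSet (size t)} {c} →
                  (lift : SubexpressionCut s → SubexpressionCut t) → (∀ K → weight Q (lift K) ≡ weight Qs K) →
                  (2 * c < 3 * count Qs → BalancedPart s Qs c) → c < 3 * count Qs → BalancedPart t Q c
  part-or-whole {s} {Qs = Qs} {c = c} lift weight-lift search c<3Qs with 3 * count Qs ≤? 2 * c
  ... | yes small = lift (whole s) ,
                    subst (Between c) (sym (trans (weight-lift (whole s)) (weight-whole {s} Qs))) (<⇒≤ c<3Qs , small)
  ... | no  large = let K , between = search (≰⇒> large) in
                    lift K , subst (Between c) (sym (weight-lift K)) between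

  balanced-part : ∀ t (Q : VertexSet (size t)) c → 2 ≤ c → 2 * c < 3 * count Q → BalancedPart t Q c
  balanced-part (vtx _) Q c 2≤c 2c<3Q
    with ≤-trans (*-monoʳ-≤ 2 2≤c) (≤-trans (<⇒≤ 2c<3Q) (*-monoʳ-≤ 3 (count-≤ {1} Q)))
  ... | s≤s (s≤s (s≤s ()))
  balanced-part (relab i j t) Q c 2≤c 2c<3Q =
    let K , between = balanced-part t Q c 2≤c 2c<3Q in relab-cut i j K , between
  balanced-part (join i j t)  Q c 2≤c 2c<3Q =
    let K , between = balanced-part t Q c 2≤c 2c<3Q in join-cut i j K , between
  balanced-part (a ⊕ b) Q c 2≤c 2c<3Q
    with one-part-heavy {a = count (Q ∘ (_↑ˡ size b))}
                        (subst (λ w → 2 * c < 3 * w) (count-++ (size a) (size b) Q) 2c<3Q)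
  ... | inj₁ c<3wa = part-or-whole (⊕-left b) (weight-⊕-left b Q) (balanced-part a _ c 2≤c) c<3wa
  ... | inj₂ c<3wb = part-or-whole (⊕-right a) (weight-⊕-right a Q) (balanced-part b _ c 2≤c) c<3wb

TwinCut-pullback : ∀ {n m k} {E : Fin m → Fin m → Bool} {E′ : Fin n → Fin n → Bool} (f : Fin n → Fin m) →
                   (∀ u v → E′ u v ≡ E (f u) (f v)) → TwinCut E k → TwinCut E′ k
TwinCut-pullback f E′≡E c = record
  { inside = inside ∘ f
  ; colour = colour ∘ f
  ; twins  = λ Sx Sx′ Sy same → trans (E′≡E _ _) (trans (twins Sx Sx′ Sy same) (sym (E′≡E _ _)))
  }
  where open TwinCut c

Between⇒Balanced : ∀ {n} (P S : VertexSet n) → Between (count P) (count (P ∩ S)) → Balanced P S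
Between⇒Balanced P S (c≤3w , 3w≤2c) = 3w≤2c , +-cancelʳ-≤ c (3 * w′) (2 * c) (begin
  3 * w′ + c               ≤⟨ +-monoʳ-≤ (3 * w′) c≤3w ⟩
  3 * w′ + 3 * w           ≡⟨ solve 2 (λ w w′ → con 3 :* w′ :+ con 3 :* w := con 2 :* (w :+ w′) :+ (w :+ w′)) refl w w′ ⟩
  2 * (w + w′) + (w + w′)  ≡⟨ cong (λ c → 2 * c + c) (sym (count-split P S)) ⟩
  2 * c + c                ∎)
  where
  open ≤-Reasoning
  open +-*-Solver
  c  = count P
  w  = count (P ∩ S)
  w′ = count (P ∖ S)

module _ {n k : ℕ} {G : Graph n} (t : CWExpr k) (f : Fin n ⤖ Fin (size t))
         (adj≡edge : ∀ u v → adj G u v ≡ edge t (Bijection.to f u) (Bijection.to f v)) where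

  private
    π = ⤖⇒↔ f
    open Inverse π using (to; from; strictlyInverseʳ)

  pullback : SubexpressionCut t → TwinCut (adj G) k
  pullback K = TwinCut-pullback to adj≡edge (SubexpressionCut.cut K)

  count-pullback : (P : VertexSet n) (S : VertexSet (size t)) → count ((P ∘ from) ∩ S) ≡ count (P ∩ (S ∘ to))
  count-pullback P S =
    trans (count-permute π _) (count-cong λ u → cong (λ x → P x ∧ S (to u)) (strictlyInverseʳ u))

  count-from : (P : VertexSet n) → count (P ∘ from) ≡ count P
  count-from P = trans (count-permute π _) (count-cong (cong P ∘ strictlyInverseʳ))

  expression-balancedCuts : BalancedCuts G k
  expression-balancedCuts P with 2 ≤? count P
  ... | no  small = pullback (whole t) , λ big → ⊥-elim (small big)
  ... | yes big   =
    let K , between = balanced-part t (P ∘ from) (count P) big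
                                    (subst (λ c → 2 * count P < 3 * c) (sym (count-from P)) 2c<3c)
    in pullback K ,
       λ _ → Between⇒Balanced P _ (subst (Between (count P)) (count-pullback P (SubexpressionCut.inside K)) between)
    where
    2c<3c : 2 * count P < 3 * count P
    2c<3c = *-monoˡ-< (count P) {{>-nonZero (≤-trans (s≤s z≤n) big)}} {2} {3} ≤-refl

balancedCuts-of-cliqueWidth : ∀ {n k} {G : Graph n} → CliqueWidth≤ k G → BalancedCuts G k
balancedCuts-of-cliqueWidth {G = G} (t , f , adj≡edge) = expression-balancedCuts {G = G} t f adj≡edge

-- Logarithmic depth

n≤2^⌈log₂n⌉ : ∀ n → n ≤ 2 ^ ⌈log₂ n ⌉
n≤2^⌈log₂n⌉ = <-rec (λ n → n ≤ 2 ^ ⌈log₂ n ⌉) bound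
  where
  bound : ∀ n → (∀ {m} → m < n → m ≤ 2 ^ ⌈log₂ m ⌉) → n ≤ 2 ^ ⌈log₂ n ⌉
  bound 0 _ = z≤n
  bound 1 _ = s≤s z≤n
  bound n@(suc (suc m)) rec = double ⌈log₂ n ⌉ 1≤⌈log₂n⌉ (⌈log₂⌈n/2⌉⌉≡⌈log₂n⌉∸1 n)
    where
    half = ⌈ n /2⌉
    n≤half+half : n ≤ half + half
    n≤half+half = ≤-trans (≤-reflexive (sym (⌊n/2⌋+⌈n/2⌉≡n n))) (+-monoˡ-≤ half (⌊n/2⌋≤⌈n/2⌉ n))
    1≤⌈log₂n⌉ : 1 ≤ ⌈log₂ n ⌉
    1≤⌈log₂n⌉ = ⌈log₂⌉-mono-≤ {2} {n} (s≤s (s≤s z≤n))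
    double : ∀ L → 1 ≤ L → ⌈log₂ half ⌉ ≡ L ∸ 1 → n ≤ 2 ^ L
    double (suc L) _ eq =
      ≤-trans n≤half+half (≤-trans (+-mono-≤ half≤ half≤) (≤-reflexive (cong (2 ^ L +_) (sym (+-identityʳ _)))))
      where
      half≤ : half ≤ 2 ^ L
      half≤ = subst (λ e → half ≤ 2 ^ e) eq (rec (⌈n/2⌉<n m))

[2^L]³≤[3^L]² : ∀ L → 2 ^ L * 2 ^ L * 2 ^ L ≤ 3 ^ L * 3 ^ L
[2^L]³≤[3^L]² zero    = ≤-refl
[2^L]³≤[3^L]² (suc L) = begin
  (2 * a) * (2 * a) * (2 * a)  ≡⟨ solve 1 (λ a → (con 2 :* a) :* (con 2 :* a) :* (con 2 :* a) := con 8 :* (a :* a :* a))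
                                         refl a ⟩
  8 * (a * a * a)              ≤⟨ *-mono-≤ (n≤1+n 8) ([2^L]³≤[3^L]² L) ⟩
  9 * (b * b)                  ≡⟨ solve 1 (λ b → con 9 :* (b :* b) := (con 3 :* b) :* (con 3 :* b)) refl b ⟩
  (3 * b) * (3 * b)            ∎
  where
  open ≤-Reasoning
  open +-*-Solver
  a = 2 ^ L
  b = 3 ^ L

n≤[3/2]^[2⌈log₂n⌉] : ∀ n → let L = ⌈log₂ n ⌉ in 2 ^ (L + L) * n ≤ 3 ^ (L + L)
n≤[3/2]^[2⌈log₂n⌉] n = begin
  2 ^ (L + L) * n            ≤⟨ *-monoʳ-≤ (2 ^ (L + L)) (n≤2^⌈log₂n⌉ n) ⟩
  2 ^ (L + L) * 2 ^ L        ≡⟨ cong (_* 2 ^ L) (^-distribˡ-+-* 2 L L) ⟩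
  2 ^ L * 2 ^ L * 2 ^ L      ≤⟨ [2^L]³≤[3^L]² L ⟩
  3 ^ L * 3 ^ L              ≡⟨ sym (^-distribˡ-+-* 3 L L) ⟩
  3 ^ (L + L)                ∎
  where
  open ≤-Reasoning
  L = ⌈log₂ n ⌉

corollary35 : ∃[ C ] (∀ (k n : ℕ) → 2 ≤ n → (G : Graph n) → CliqueWidth≤ k G →
                ∃[ H ] (IsPartialOrientation G H ×
                        (∀ v → outdeg H v ≤ C * k * ⌈log₂ n ⌉) ×
                        WeakGuidance G H))
corollary35 = 4 , guidance-system
  where
  guidance-system : ∀ k n → 2 ≤ n → (G : Graph n) → CliqueWidth≤ k G →
                    ∃[ H ] (IsPartialOrientation G H × (∀ v → outdeg H v ≤ 4 * k * ⌈log₂ n ⌉) × WeakGuidance G H)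
  guidance-system k n _ G cw =
    let H , orientation , degree , guidance =
          weakGuidance-of-balancedCuts G (balancedCuts-of-cliqueWidth {G = G} cw) (L + L) (n≤[3/2]^[2⌈log₂n⌉] n)
    in H , orientation , (λ v → subst (outdeg H v ≤_) (degree-bound L k) (degree v)) , guidance
    where
    L = ⌈log₂ n ⌉
    degree-bound : ∀ L k → (L + L) * (k + k) ≡ 4 * k * L
    degree-bound = solve 2 (λ L k → (L :+ L) :* (k :+ k) := con 4 :* k :* L) refl
      where open +-*-Solver
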